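{- Let $k\ge 2$ be an integer and let $G$ be a $C_4$-split graph with $C_4$-split partition $(C,S,I)$. The following are equivalent: (1) $G$ is $(1,k)$-polar; (2) $G$ has no induced subgraph isomorphic to $K_1\oplus C_4$; (3) if $G$ is strict, then the maximum degree $\Delta_G$ satisfies $\Delta_G\le 2$. Consequently, the only $C_4$-split minimal monopolar obstruction is $K_1\oplus C_4$, and, if $G$ is strict, $G$ is monopolar if and only if $\Delta_G\le 2$.
   Context: All graphs are finite and simple; $\oplus$ denotes join. A $C_4$-split partition of $G$ is a partition $(C,S,I)$ of $V_G$ with $C$ a clique, $I$ independent, $S=\varnothing$ or $G[S]\cong C_4$, every vertex of $C$ adjacent to every vertex of $S$, and no edges between $I$ and $S$; $G$ is $C_4$-split if it has one and strict if it has one with $S\neq\varnothing$. $G$ is $(1,k)$-polar if $V_G$ has a partition $(A,B)$ with $A$ independent and $G[B]$ a disjoint union of at most $k$ complete graphs; monopolar if the same holds without bound on the number of complete graphs. A minimal monopolar obstruction is a non-monopolar graph all of whose vertex-deleted subgraphs are monopolar. -}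

module Defs where

open import Data.Nat using (ℕ; zero; suc; _⊔_; _≤_)
open import Data.Bool using (Bool; true; false)
open import Data.Fin using (Fin; zero; suc; punchIn)
open import Data.List using (List; foldr; map; filter; length)
open import Data.List.Base using (allFin)
open import Data.Product using (Σ; ∃; _×_; _,_)
open import Data.Sum using (_⊎_)
open import Relation.Nullary using (¬_)
open import Relation.Binary.PropositionalEquality using (_≡_; _≢_)
open import Function.Definitions using (Injective)
open import Data.Bool.Properties using () renaming (_≟_ to _≟B_)
open import Relation.Nullary.Decidable using (Dec)

record Graph (n : ℕ) : Set where
  field
    adj     : Fin n → Fin n → Bool
    symm    : ∀ u v → adj u v ≡ adj v u
    irrefl  : ∀ v → adj v v ≡ false
open Graph public

Adj : ∀ {n} → Graph n → Fin n → Fin n → Set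
Adj G u v = adj G u v ≡ true

degree : ∀ {n} → Graph n → Fin n → ℕ
degree {n} G v = length (filter (λ u → adj G v u ≟B true) (allFin n))

maxDegree : ∀ {n} → Graph n → ℕ
maxDegree {n} G = foldr _⊔_ 0 (map (degree G) (allFin n))

record _≅_ {n m : ℕ} (G : Graph n) (H : Graph m) : Set where
  field
    to      : Fin n → Fin m
    from    : Fin m → Fin n
    from-to : ∀ v → from (to v) ≡ v
    to-from : ∀ w → to (from w) ≡ w
    pres    : ∀ u v → adj H (to u) (to v) ≡ adj G u v

HasInduced : ∀ {n m} → Graph n → Graph m → Set
HasInduced {n} {m} G H =
  Σ (Fin m → Fin n) λ f → Injective _≡_ _≡_ f × (∀ i j → adj G (f i) (f j) ≡ adj H i j)

-- The cycle C4 on 0-1-2-3-0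
c4adj : Fin 4 → Fin 4 → Bool
c4adj zero (suc zero) = true
c4adj zero (suc (suc (suc zero))) = true
c4adj (suc zero) zero = true
c4adj (suc zero) (suc (suc zero)) = true
c4adj (suc (suc zero)) (suc zero) = true
c4adj (suc (suc zero)) (suc (suc (suc zero))) = true
c4adj (suc (suc (suc zero))) (suc (suc zero)) = true
c4adj (suc (suc (suc zero))) zero = true
c4adj _ _ = false

k1c4adj : Fin 5 → Fin 5 → Bool
k1c4adj zero zero = false
k1c4adj zero (suc _) = true
k1c4adj (suc _) zero = true
k1c4adj (suc i) (suc j) = c4adj i j

private
  c4symm : ∀ i j → c4adj i j ≡ c4adj j i
  c4symm zero zero = _≡_.refl
  c4symm zero (suc zero) = _≡_.refl
  c4symm zero (suc (suc zero)) = _≡_.refl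
  c4symm zero (suc (suc (suc zero))) = _≡_.refl
  c4symm (suc zero) zero = _≡_.refl
  c4symm (suc zero) (suc zero) = _≡_.refl
  c4symm (suc zero) (suc (suc zero)) = _≡_.refl
  c4symm (suc zero) (suc (suc (suc zero))) = _≡_.refl
  c4symm (suc (suc zero)) zero = _≡_.refl
  c4symm (suc (suc zero)) (suc zero) = _≡_.refl
  c4symm (suc (suc zero)) (suc (suc zero)) = _≡_.refl
  c4symm (suc (suc zero)) (suc (suc (suc zero))) = _≡_.refl
  c4symm (suc (suc (suc zero))) zero = _≡_.refl
  c4symm (suc (suc (suc zero))) (suc zero) = _≡_.refl
  c4symm (suc (suc (suc zero))) (suc (suc zero)) = _≡_.refl
  c4symm (suc (suc (suc zero))) (suc (suc (suc zero))) = _≡_.refl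

  c4irr : ∀ i → c4adj i i ≡ false
  c4irr zero = _≡_.refl
  c4irr (suc zero) = _≡_.refl
  c4irr (suc (suc zero)) = _≡_.refl
  c4irr (suc (suc (suc zero))) = _≡_.refl

  k1symm : ∀ i j → k1c4adj i j ≡ k1c4adj j i
  k1symm zero zero = _≡_.refl
  k1symm zero (suc _) = _≡_.refl
  k1symm (suc _) zero = _≡_.refl
  k1symm (suc i) (suc j) = c4symm i j

  k1irr : ∀ i → k1c4adj i i ≡ false
  k1irr zero = _≡_.refl
  k1irr (suc i) = c4irr i

C4 : Graph 4
C4 = record { adj = c4adj ; symm = c4symm ; irrefl = c4irr }

K1⊕C4 : Graph 5
K1⊕C4 = record { adj = k1c4adj ; symm = k1symm ; irrefl = k1irr }

_-ᵛ_ : ∀ {m} → Graph (suc m) → Fin (suc m) → Graph m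
G -ᵛ v = record
  { adj = λ i j → adj G (punchIn v i) (punchIn v j)
  ; symm = λ i j → symm G (punchIn v i) (punchIn v j)
  ; irrefl = λ i → irrefl G (punchIn v i) }

data Part : Set where
  partC partS partI : Part

IsC4SplitPartition : ∀ {n} → Graph n → (Fin n → Part) → Set
IsC4SplitPartition {n} G P =
    (∀ u v → u ≢ v → P u ≡ partC → P v ≡ partC → Adj G u v)
  × (∀ u v → P u ≡ partI → P v ≡ partI → adj G u v ≡ false)
  × ( (∀ v → ¬ (P v ≡ partS))
    ⊎ Σ (Fin 4 → Fin n) (λ f →                                         -- or G[S] ≅ C4
          Injective _≡_ _≡_ f
        × (∀ v → P v ≡ partS → ∃ λ i → f i ≡ v)
        × (∀ i → P (f i) ≡ partS)
        × (∀ i j → adj G (f i) (f j) ≡ c4adj i j)))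
  × (∀ u v → P u ≡ partC → P v ≡ partS → Adj G u v)
  × (∀ u v → P u ≡ partI → P v ≡ partS → adj G u v ≡ false)

IsC4Split : ∀ {n} → Graph n → Set
IsC4Split {n} G = Σ (Fin n → Part) λ P → IsC4SplitPartition G P

IsStrictC4Split : ∀ {n} → Graph n → Set
IsStrictC4Split {n} G =
  Σ (Fin n → Part) λ P → IsC4SplitPartition G P × ∃ λ v → P v ≡ partS

-- (1,k)-polar: a partition (A,B) (inA v = true iff v ∈ A) with A independent and
-- G[B] a disjoint union of at most k complete graphs, witnessed by assigning to each
-- vertex of B the index (in Fin k) of its complete component.
Is1kPolar : ∀ {n} → ℕ → Graph n → Set
Is1kPolar {n} k G =
  Σ (Fin n → Bool) λ inA → Σ (Fin n → Fin k) λ comp →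
      (∀ u v → inA u ≡ true → inA v ≡ true → adj G u v ≡ false)
    × (∀ u v → inA u ≡ false → inA v ≡ false → u ≢ v →
         (Adj G u v → comp u ≡ comp v) × (comp u ≡ comp v → Adj G u v))

IsMonopolar : ∀ {n} → Graph n → Set
IsMonopolar G = ∃ λ k → Is1kPolar k G

IsMinimalMonopolarObstruction : ∀ {n} → Graph n → Set
IsMinimalMonopolarObstruction {zero} G = ¬ IsMonopolar G
IsMinimalMonopolarObstruction {suc m} G =
  ¬ IsMonopolar G × (∀ v → IsMonopolar (G -ᵛ v))

{-# OPTIONS --safe #-}
module Submission where

-- K1 ⊕ C4 is not (1,k)-polar for any k: if the hub is in A the rim lies in B and contains an
-- induced P3, and otherwise an opposite pair of rim vertices lies in B and forms an induced P3
-- with the hub. Polarity passes to induced subgraphs, so (1,k)-polar graphs are K1 ⊕ C4-free.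
-- Conversely, let (C, S, I) be a C4-split partition. A vertex of C together with S induces
-- K1 ⊕ C4, so a K1 ⊕ C4-free graph either has S = ∅, and is split (A = I, B = C), or has C = ∅,
-- and then A = I ∪ {s₀, s₂}, B = {s₁, s₃} is a (1,2)-polar partition. In the second case
-- every vertex has degree at most 2, while the hub of an induced K1 ⊕ C4 has degree 4 and a split
-- graph has no induced C4. Finally, an induced K1 ⊕ C4 in a C4-split minimal obstruction must
-- cover every vertex, since deleting a vertex outside it leaves a non-monopolar graph.

open import Defs
open import Data.Nat using (ℕ; zero; suc; _≤_; z≤n; s≤s)
open import Data.Nat.Properties using (≤-refl; ≤-trans; ⊔-lub; m≤n⇒m≤n⊔o; m≤n⇒m≤o⊔n)
open import Data.Bool using (Bool; true; false)
open import Data.Bool.Properties using () renaming (_≟_ to _≟B_)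
open import Data.Fin using (Fin; zero; suc; #_; punchIn; punchOut; _≟_)
open import Data.Fin.Properties
  using (¬Fin0; suc-injective; any?; all?; injective⇒≤; punchIn-injective; punchInᵢ≢i; punchIn-punchOut)
open import Data.List using (List; []; _∷_; length; filter; map; allFin; lookup)
open import Data.List.Properties using (foldr-preservesᵇ; foldr-preservesᵒ)
import Data.List.Relation.Unary.All as All
import Data.List.Relation.Unary.All.Properties as All
import Data.List.Relation.Unary.Any as Any
import Data.List.Relation.Unary.Any.Properties as Any
open import Data.List.Relation.Unary.AllPairs using (_∷_)
open import Data.List.Relation.Unary.Unique.Propositional using (Unique)
import Data.List.Relation.Unary.Unique.Propositional.Properties as Unique
open import Data.List.Membership.Propositional using (_∈_)
open import Data.List.Membership.Propositional.Properties
  using (∈-filter⁺; ∈-filter⁻; ∈-allFin; ∈-lookup; ∈-map⁺; ∈-map⁻)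
import Data.List.Membership.Setoid.Properties as SetoidMembership
open import Data.List.Relation.Binary.Subset.Propositional using (_⊆_)
open import Data.Product using (∃; _×_; _,_; proj₁; proj₂)
open import Data.Sum using (_⊎_; inj₁; inj₂; [_,_])
open import Data.Empty using (⊥; ⊥-elim)
open import Function using (_∘_; id)
open import Function.Bundles using (_⇔_; mk⇔)
open import Function.Definitions using (Injective)
open import Relation.Nullary using (¬_; Dec; yes; no)
open import Relation.Nullary.Decidable using (_×-dec_; _→-dec_; ¬?; toWitness)
open import Relation.Binary.PropositionalEquality hiding ([_])

true≢false : true ≢ false
true≢false ()

HasInduced-trans : ∀ {n m l} (G : Graph n) (H : Graph m) (K : Graph l) →
  HasInduced G H → HasInduced H K → HasInduced G K
HasInduced-trans _ _ _ (f , f-inj , f-pres) (g , g-inj , g-pres) =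
  f ∘ g , g-inj ∘ f-inj , λ i j → trans (f-pres (g i) (g j)) (g-pres i j)

≅-sym : ∀ {n m} {G : Graph n} {H : Graph m} → G ≅ H → H ≅ G
≅-sym {H = H} iso = record
  { to = from ; from = to ; from-to = to-from ; to-from = from-to
  ; pres = λ u v →
      sym (trans (cong₂ (adj H) (sym (to-from u)) (sym (to-from v))) (pres (from u) (from v))) }
  where open _≅_ iso

≅⇒HasInduced : ∀ {n m} {G : Graph n} {H : Graph m} → G ≅ H → HasInduced H G
≅⇒HasInduced iso = to , to-injective , pres
  where
  open _≅_ iso
  to-injective : Injective _≡_ _≡_ to
  to-injective {x} {y} eq = trans (sym (from-to x)) (trans (cong from eq) (from-to y))

-ᵛ-HasInduced : ∀ {m} (G : Graph (suc m)) v → HasInduced G (G -ᵛ v)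
-ᵛ-HasInduced G v = punchIn v , punchIn-injective v _ _ , λ _ _ → refl

HasInduced-avoiding : ∀ {m l} (G : Graph (suc m)) (H : Graph l) (v : Fin (suc m)) →
  ((f , _) : HasInduced G H) → (∀ i → f i ≢ v) → HasInduced (G -ᵛ v) H
HasInduced-avoiding {m} {l} G H v (f , f-inj , f-pres) f≢v = f′ , f′-inj , f′-pres
  where
  f′ : Fin l → Fin m
  f′ i = punchOut (f≢v i ∘ sym)
  punchIn-f′ : ∀ i → punchIn v (f′ i) ≡ f i
  punchIn-f′ i = punchIn-punchOut (f≢v i ∘ sym)
  f′-inj : Injective _≡_ _≡_ f′
  f′-inj {i} {j} eq = f-inj (trans (sym (punchIn-f′ i)) (trans (cong (punchIn v) eq) (punchIn-f′ j)))
  f′-pres : ∀ i j → adj G (punchIn v (f′ i)) (punchIn v (f′ j)) ≡ adj H i j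
  f′-pres i j = trans (cong₂ (adj G) (punchIn-f′ i) (punchIn-f′ j)) (f-pres i j)

surjective-HasInduced⇒≅ : ∀ {n m} (G : Graph n) (H : Graph m) ((f , _) : HasInduced G H) →
  (∀ v → ∃ λ i → f i ≡ v) → G ≅ H
surjective-HasInduced⇒≅ {n} {m} G H (f , f-inj , f-pres) surj = record
  { to = f⁻¹ ; from = f
  ; from-to = f-f⁻¹
  ; to-from = λ i → f-inj (f-f⁻¹ (f i))
  ; pres = λ u v → trans (sym (f-pres (f⁻¹ u) (f⁻¹ v))) (cong₂ (adj G) (f-f⁻¹ u) (f-f⁻¹ v)) }
  where
  f⁻¹ : Fin n → Fin m
  f⁻¹ v = proj₁ (surj v)
  f-f⁻¹ : ∀ v → f (f⁻¹ v) ≡ v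
  f-f⁻¹ v = proj₂ (surj v)

C4⊆K1⊕C4 : HasInduced K1⊕C4 C4
C4⊆K1⊕C4 = suc , suc-injective , λ _ _ → refl

IsPolarLabelling : ∀ {n} k (G : Graph n) → (Fin n → Bool) → (Fin n → Fin k) → Set
IsPolarLabelling k G inA comp =
    (∀ u v → inA u ≡ true → inA v ≡ true → adj G u v ≡ false)
  × (∀ u v → inA u ≡ false → inA v ≡ false → u ≢ v →
       (Adj G u v → comp u ≡ comp v) × (comp u ≡ comp v → Adj G u v))

isPolarLabelling? : ∀ {n} k (G : Graph n) inA comp → Dec (IsPolarLabelling k G inA comp)
isPolarLabelling? k G inA comp =
        all? (λ u → all? λ v → inA u ≟B true →-dec inA v ≟B true →-dec adj G u v ≟B false)
  ×-dec all? (λ u → all? λ v → inA u ≟B false →-dec inA v ≟B false →-dec ¬? (u ≟ v) →-dec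
          (adj G u v ≟B true →-dec comp u ≟ comp v) ×-dec (comp u ≟ comp v →-dec adj G u v ≟B true))

Is1kPolar-induced : ∀ {n m k} (G : Graph n) (H : Graph m) → HasInduced G H → Is1kPolar k G → Is1kPolar k H
Is1kPolar-induced G H (f , f-inj , f-pres) (inA , comp , A-indep , B-cliques) =
  inA ∘ f , comp ∘ f ,
  (λ u v uA vA → trans (sym (f-pres u v)) (A-indep (f u) (f v) uA vA)) ,
  λ u v uB vB u≢v →
    let (adj⇒comp , comp⇒adj) = B-cliques (f u) (f v) uB vB (u≢v ∘ f-inj)
    in adj⇒comp ∘ trans (f-pres u v) , trans (sym (f-pres u v)) ∘ comp⇒adj

module PolarPartition {n k} (G : Graph n) (polar : Is1kPolar k G) where

  inA : Fin n → Bool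
  inA = proj₁ polar

  comp : Fin n → Fin k
  comp = proj₁ (proj₂ polar)

  A-independent : ∀ u v → inA u ≡ true → inA v ≡ true → adj G u v ≡ false
  A-independent = proj₁ (proj₂ (proj₂ polar))

  B-cliques : ∀ u v → inA u ≡ false → inA v ≡ false → u ≢ v →
              (Adj G u v → comp u ≡ comp v) × (comp u ≡ comp v → Adj G u v)
  B-cliques = proj₂ (proj₂ (proj₂ polar))

  neighbour-of-A-in-B : ∀ {u} v → inA u ≡ true → Adj G u v → inA v ≡ false
  neighbour-of-A-in-B {u} v uA uv with inA v in vA
  ... | true = ⊥-elim (true≢false (trans (sym uv) (A-independent u v uA vA)))
  ... | false = refl

  B-induces-no-P3 : ∀ {x y z} → inA x ≡ false → inA y ≡ false → inA z ≡ false → x ≢ z →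
    Adj G x y → Adj G y z → adj G x z ≡ false → ⊥
  B-induces-no-P3 {x} {y} {z} xB yB zB x≢z xy yz xz =
    true≢false (trans (sym (proj₂ (B-cliques x z xB zB x≢z) comp-x≡comp-z)) xz)
    where
    irreflexive : ∀ {u v} → Adj G u v → u ≢ v
    irreflexive {u} uv refl = true≢false (trans (sym uv) (irrefl G u))
    comp-x≡comp-z : comp x ≡ comp z
    comp-x≡comp-z = trans (proj₁ (B-cliques x y xB yB (irreflexive xy)) xy)
                          (proj₁ (B-cliques y z yB zB (irreflexive yz)) yz)

K1⊕C4-not1kPolar : ∀ k → ¬ Is1kPolar k K1⊕C4
K1⊕C4-not1kPolar k polar = contradiction
  where
  open PolarPartition K1⊕C4 polar
  hub : Fin 5
  hub = zero
  rim : Fin 4 → Fin 5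
  rim = suc
  contradiction : ⊥
  contradiction with inA hub in hubA
  ... | true = B-induces-no-P3 (rim-in-B (# 0)) (rim-in-B (# 1)) (rim-in-B (# 2)) (λ ()) refl refl refl
    where
    rim-in-B : ∀ i → inA (rim i) ≡ false
    rim-in-B i = neighbour-of-A-in-B (rim i) hubA refl
  ... | false with inA (rim (# 0)) in r0 | inA (rim (# 2)) in r2
  ... | true  | _    = B-induces-no-P3 (neighbour-of-A-in-B (rim (# 1)) r0 refl) hubA
                         (neighbour-of-A-in-B (rim (# 3)) r0 refl) (λ ()) refl refl refl
  ... | false | true = B-induces-no-P3 (neighbour-of-A-in-B (rim (# 1)) r2 refl) hubA
                         (neighbour-of-A-in-B (rim (# 3)) r2 refl) (λ ()) refl refl refl
  ... | false | false = B-induces-no-P3 r0 hubA r2 (λ ()) refl refl refl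

1kPolar⇒K1⊕C4-free : ∀ {n k} (G : Graph n) → Is1kPolar k G → ¬ HasInduced G K1⊕C4
1kPolar⇒K1⊕C4-free {k = k} G polar K1⊕C4⊆G = K1⊕C4-not1kPolar k (Is1kPolar-induced G K1⊕C4 K1⊕C4⊆G polar)

monopolar⇒K1⊕C4-free : ∀ {n} (G : Graph n) → IsMonopolar G → ¬ HasInduced G K1⊕C4
monopolar⇒K1⊕C4-free G (_ , polar) = 1kPolar⇒K1⊕C4-free G polar

-- Deleting the hub leaves C4 = A ∪ B with A = {0, 2} and B = {1, 3}; deleting a rim vertex r
-- leaves K1 ⊕ P3, split into its two ends A (the rim neighbours of r) and the edge B.
K1⊕C4-deleted-2Polar : ∀ w → Is1kPolar 2 (K1⊕C4 -ᵛ w)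
K1⊕C4-deleted-2Polar zero = inA , comp , toWitness {a? = isPolarLabelling? 2 (K1⊕C4 -ᵛ zero) inA comp} _
  where
  inA : Fin 4 → Bool
  inA i = c4adj (# 1) i
  comp : Fin 4 → Fin 2
  comp (suc zero) = zero
  comp _          = suc zero
K1⊕C4-deleted-2Polar (suc r) =
  inA r , (λ _ → zero) ,
  toWitness {a? = all? λ r → isPolarLabelling? 2 (K1⊕C4 -ᵛ suc r) (inA r) (λ _ → zero)} _ r
  where
  inA : Fin 4 → Fin 4 → Bool
  inA r zero = false
  inA r (suc i) = c4adj r (punchIn r i)

split⇒1kPolar : ∀ {n k} (G : Graph n) (inA : Fin n → Bool) →
  (∀ u v → inA u ≡ true → inA v ≡ true → adj G u v ≡ false) →
  (∀ u v → inA u ≡ false → inA v ≡ false → u ≢ v → Adj G u v) →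
  Is1kPolar (suc k) G
split⇒1kPolar G inA A-indep B-clique =
  inA , (λ _ → zero) , A-indep , λ u v uB vB u≢v → (λ _ → refl) , (λ _ → B-clique u v uB vB u≢v)

independent-except-nonedge⇒2Polar : ∀ {n k} (G : Graph n) {a b : Fin n} → a ≢ b → adj G a b ≡ false →
  (∀ u v → u ≢ a × u ≢ b → v ≢ a × v ≢ b → adj G u v ≡ false) →
  Is1kPolar (suc (suc k)) G
independent-except-nonedge⇒2Polar {n} {k} G {a} {b} a≢b ab A-indep = inA , comp , A-indep′ , B-cliques
  where
  inA : Fin n → Bool
  inA v with v ≟ a | v ≟ b
  ... | no _ | no _ = true
  ... | _    | _    = false
  inA⇒∉ : ∀ v → inA v ≡ true → v ≢ a × v ≢ b
  inA⇒∉ v vA with v ≟ a | v ≟ b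
  ... | no v≢a | no v≢b = v≢a , v≢b
  inB⇒∈ : ∀ v → inA v ≡ false → v ≡ a ⊎ v ≡ b
  inB⇒∈ v vB with v ≟ a | v ≟ b
  ... | yes v≡a | _     = inj₁ v≡a
  ... | no _    | yes v≡b = inj₂ v≡b
  comp : Fin n → Fin (suc (suc k))
  comp v with v ≟ a
  ... | yes _ = zero
  ... | no _  = suc zero
  comp-a≢comp-b : comp a ≢ comp b
  comp-a≢comp-b with a ≟ a | b ≟ a
  ... | no a≢a | _ = ⊥-elim (a≢a refl)
  ... | yes _  | yes b≡a = ⊥-elim (a≢b (sym b≡a))
  ... | yes _  | no _ = λ ()
  A-indep′ : ∀ u v → inA u ≡ true → inA v ≡ true → adj G u v ≡ false
  A-indep′ u v uA vA = A-indep u v (inA⇒∉ u uA) (inA⇒∉ v vA)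
  B-cliques : ∀ u v → inA u ≡ false → inA v ≡ false → u ≢ v →
              (Adj G u v → comp u ≡ comp v) × (comp u ≡ comp v → Adj G u v)
  B-cliques u v uB vB u≢v with inB⇒∈ u uB | inB⇒∈ v vB
  ... | inj₁ refl | inj₁ refl = ⊥-elim (u≢v refl)
  ... | inj₂ refl | inj₂ refl = ⊥-elim (u≢v refl)
  ... | inj₁ refl | inj₂ refl =
    (λ uv → ⊥-elim (true≢false (trans (sym uv) ab))) , (λ eq → ⊥-elim (comp-a≢comp-b eq))
  ... | inj₂ refl | inj₁ refl =
    (λ vu → ⊥-elim (true≢false (trans (sym vu) (trans (symm G b a) ab)))) ,
    (λ eq → ⊥-elim (comp-a≢comp-b (sym eq)))

lookup-injective : ∀ {A : Set} {xs : List A} → Unique xs → Injective _≡_ _≡_ (lookup xs)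
lookup-injective (_    ∷ _)      {zero}  {zero}  _  = refl
lookup-injective (x∉xs ∷ _)      {zero}  {suc j} eq = ⊥-elim (All.lookup x∉xs (∈-lookup j) eq)
lookup-injective (x∉xs ∷ _)      {suc i} {zero}  eq = ⊥-elim (All.lookup x∉xs (∈-lookup i) (sym eq))
lookup-injective (_    ∷ unique) {suc i} {suc j} eq = cong suc (lookup-injective unique eq)

Unique-⊆⇒length≤ : ∀ {A : Set} {xs ys : List A} → Unique xs → xs ⊆ ys → length xs ≤ length ys
Unique-⊆⇒length≤ {A} {xs} unique xs⊆ys =
  injective⇒≤ {f = λ i → Any.index (xs⊆ys (∈-lookup i))} λ {i} {j} eq →
    lookup-injective unique (SetoidMembership.index-injective (setoid A) _ _ eq)

neighbours : ∀ {n} → Graph n → Fin n → List (Fin n)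
neighbours {n} G v = filter (λ u → adj G v u ≟B true) (allFin n)

neighbours-unique : ∀ {n} (G : Graph n) v → Unique (neighbours G v)
neighbours-unique {n} G v = Unique.filter⁺ (λ u → adj G v u ≟B true) (Unique.allFin⁺ n)

degree≤length : ∀ {n} (G : Graph n) v {ys} → (∀ {u} → Adj G v u → u ∈ ys) → degree G v ≤ length ys
degree≤length {n} G v nbrs⊆ys = Unique-⊆⇒length≤ (neighbours-unique G v)
  (nbrs⊆ys ∘ proj₂ ∘ ∈-filter⁻ (λ u → adj G v u ≟B true) {xs = allFin n})

length≤degree : ∀ {n} (G : Graph n) v {ys} → Unique ys → (∀ {u} → u ∈ ys → Adj G v u) →
  length ys ≤ degree G v
length≤degree G v unique ys⊆nbrs = Unique-⊆⇒length≤ unique λ {u} u∈ys →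
  ∈-filter⁺ (λ u → adj G v u ≟B true) (∈-allFin u) (ys⊆nbrs u∈ys)

maxDegree≤ : ∀ {n} (G : Graph n) {d} → (∀ v → degree G v ≤ d) → maxDegree G ≤ d
maxDegree≤ {n} G {d} bound =
  foldr-preservesᵇ {P = _≤ d} ⊔-lub z≤n (All.map⁺ (All.tabulate {xs = allFin n} λ {v} _ → bound v))

degree≤maxDegree : ∀ {n} (G : Graph n) v → degree G v ≤ maxDegree G
degree≤maxDegree {n} G v =
  foldr-preservesᵒ {P = degree G v ≤_} (λ x y → [ m≤n⇒m≤n⊔o y , m≤n⇒m≤o⊔n x ]) 0 (map (degree G) (allFin n))
    (inj₂ (Any.map⁺ (Any.map (λ { refl → ≤-refl }) (∈-allFin v))))

K1⊕C4⊆G⇒4≤maxDegree : ∀ {n} (G : Graph n) → HasInduced G K1⊕C4 → 4 ≤ maxDegree G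
K1⊕C4⊆G⇒4≤maxDegree {n} G (g , g-inj , g-pres) =
  ≤-trans (length≤degree G (g zero) {ys = rim} rim-unique rim-adjacent) (degree≤maxDegree G (g zero))
  where
  rim : List (Fin n)
  rim = map (g ∘ suc) (allFin 4)
  rim-unique : Unique rim
  rim-unique = Unique.map⁺ (suc-injective ∘ g-inj) (Unique.allFin⁺ 4)
  rim-adjacent : ∀ {u} → u ∈ rim → Adj G (g zero) u
  rim-adjacent u∈rim with ∈-map⁻ (g ∘ suc) u∈rim
  ... | i , _ , refl = g-pres zero (suc i)

cone-over-C4⇒K1⊕C4 : ∀ {n} (G : Graph n) ((f , _) : HasInduced G C4) (c : Fin n) →
  (∀ i → Adj G c (f i)) → HasInduced G K1⊕C4
cone-over-C4⇒K1⊕C4 {n} G (f , f-inj , f-pres) c c-complete = g , g-inj , g-pres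
  where
  g : Fin 5 → Fin n
  g zero    = c
  g (suc i) = f i
  c≢f : ∀ i → c ≢ f i
  c≢f i refl = true≢false (trans (sym (c-complete i)) (irrefl G c))
  g-inj : Injective _≡_ _≡_ g
  g-inj {zero}  {zero}  _  = refl
  g-inj {zero}  {suc j} eq = ⊥-elim (c≢f j eq)
  g-inj {suc i} {zero}  eq = ⊥-elim (c≢f i (sym eq))
  g-inj {suc i} {suc j} eq = cong suc (f-inj eq)
  g-pres : ∀ i j → adj G (g i) (g j) ≡ k1c4adj i j
  g-pres zero    zero    = irrefl G c
  g-pres zero    (suc j) = c-complete j
  g-pres (suc i) zero    = trans (symm G (f i) c) (c-complete i)
  g-pres (suc i) (suc j) = f-pres i j

C4-neighbours : Fin 4 → List (Fin 4)
C4-neighbours i = next i ∷ prev i ∷ []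
  where
  next prev : Fin 4 → Fin 4
  next zero                   = # 1
  next (suc zero)             = # 2
  next (suc (suc zero))       = # 3
  next (suc (suc (suc zero))) = # 0
  prev zero                   = # 3
  prev (suc zero)             = # 0
  prev (suc (suc zero))       = # 1
  prev (suc (suc (suc zero))) = # 2

C4-adjacent⇒∈neighbours : ∀ i j → Adj C4 i j → j ∈ C4-neighbours i
C4-adjacent⇒∈neighbours =
  toWitness {a? = all? λ i → all? λ j → c4adj i j ≟B true →-dec Any.any? (j ≟_) (C4-neighbours i)} _

C4-evens-nonadjacent : ∀ i j → i ≢ # 1 × i ≢ # 3 → j ≢ # 1 × j ≢ # 3 → c4adj i j ≡ false
C4-evens-nonadjacent =
  toWitness {a? = all? λ i → all? λ j → (¬? (i ≟ # 1) ×-dec ¬? (i ≟ # 3))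
                                   →-dec (¬? (j ≟ # 1) ×-dec ¬? (j ≟ # 3))
                                   →-dec c4adj i j ≟B false} _

isI : Part → Bool
isI partI = true
isI _     = false

isI⇒partI : ∀ {p} → isI p ≡ true → p ≡ partI
isI⇒partI {partI} _ = refl

isC? : (p : Part) → Dec (p ≡ partC)
isC? partC = yes refl
isC? partS = no λ ()
isC? partI = no λ ()

C4-split-without-S⇒C4-free : ∀ {n} (G : Graph n) {P} → IsC4SplitPartition G P → (∀ v → P v ≢ partS) →
  ¬ HasInduced G C4
C4-split-without-S⇒C4-free G {P} (clique , indep , _) noS (g , g-inj , g-pres) = contradiction
  where
  not-both-C : ∀ i j → c4adj i j ≡ false → i ≢ j → P (g i) ≡ partC → P (g j) ≡ partC → ⊥
  not-both-C i j ij i≢j Ci Cj =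
    true≢false (trans (sym (clique (g i) (g j) (i≢j ∘ g-inj) Ci Cj)) (trans (g-pres i j) ij))
  I-neighbour-is-C : ∀ i j → c4adj i j ≡ true → P (g i) ≡ partI → P (g j) ≡ partC
  I-neighbour-is-C i j ij Ii with P (g j) in Pj
  ... | partC = refl
  ... | partS = ⊥-elim (noS (g j) Pj)
  ... | partI = ⊥-elim (true≢false (trans (sym (trans (g-pres i j) ij)) (indep (g i) (g j) Ii Pj)))
  contradiction : ⊥
  contradiction with P (g (# 0)) in P0 | P (g (# 2)) in P2
  ... | partS | _     = noS _ P0
  ... | _     | partS = noS _ P2
  ... | partC | partC = not-both-C (# 0) (# 2) refl (λ ()) P0 P2
  ... | partI | _     = not-both-C (# 1) (# 3) refl (λ ())
                          (I-neighbour-is-C (# 0) (# 1) refl P0) (I-neighbour-is-C (# 0) (# 3) refl P0)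
  ... | _     | partI = not-both-C (# 1) (# 3) refl (λ ())
                          (I-neighbour-is-C (# 2) (# 1) refl P2) (I-neighbour-is-C (# 2) (# 3) refl P2)

C4-split⇒K1⊕C4⊎1kPolar : ∀ {n k} → 2 ≤ k → (G : Graph n) {P : Fin n → Part} → IsC4SplitPartition G P →
  HasInduced G K1⊕C4 ⊎ Is1kPolar k G
C4-split⇒K1⊕C4⊎1kPolar {k = suc _} (s≤s _) G {P} (clique , indep , inj₁ noS , _) =
  inj₂ (split⇒1kPolar G (isI ∘ P) I-indep C-clique)
  where
  I-indep : ∀ u v → isI (P u) ≡ true → isI (P v) ≡ true → adj G u v ≡ false
  I-indep u v uI vI = indep u v (isI⇒partI uI) (isI⇒partI vI)
  notI⇒C : ∀ v → isI (P v) ≡ false → P v ≡ partC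
  notI⇒C v vC with P v in Pv
  ... | partC = refl
  ... | partS = ⊥-elim (noS v Pv)
  C-clique : ∀ u v → isI (P u) ≡ false → isI (P v) ≡ false → u ≢ v → Adj G u v
  C-clique u v uC vC u≢v = clique u v u≢v (notI⇒C u uC) (notI⇒C v vC)
C4-split⇒K1⊕C4⊎1kPolar {k = suc (suc _)} (s≤s (s≤s _)) G {P}
  (clique , indep , inj₂ (f , f-inj , f-onto , fS , f-pres) , CS , IS) with any? (isC? ∘ P)
... | yes (c , Pc) = inj₁ (cone-over-C4⇒K1⊕C4 G (f , f-inj , f-pres) c λ i → CS c (f i) Pc (fS i))
... | no noC =
  inj₂ (independent-except-nonedge⇒2Polar G (f1≢f3 ∘ f-inj) (f-pres (# 1) (# 3)) off-B-independent)
  where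
  f1≢f3 : # 1 ≢ # 3
  f1≢f3 ()
  preimage-avoids : ∀ {i} → f i ≢ f (# 1) × f i ≢ f (# 3) → i ≢ # 1 × i ≢ # 3
  preimage-avoids (≢f1 , ≢f3) = ≢f1 ∘ cong f , ≢f3 ∘ cong f
  off-B-independent : ∀ u v → u ≢ f (# 1) × u ≢ f (# 3) → v ≢ f (# 1) × v ≢ f (# 3) → adj G u v ≡ false
  off-B-independent u v u∉B v∉B with P u in Pu | P v in Pv
  ... | partC | _     = ⊥-elim (noC (u , Pu))
  ... | _     | partC = ⊥-elim (noC (v , Pv))
  ... | partI | partI = indep u v Pu Pv
  ... | partI | partS = IS u v Pu Pv
  ... | partS | partI = trans (symm G u v) (IS v u Pv Pu)
  ... | partS | partS with f-onto u Pu | f-onto v Pv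
  ... | i , refl | j , refl =
    trans (f-pres i j) (C4-evens-nonadjacent i j (preimage-avoids u∉B) (preimage-avoids v∉B))

K1⊕C4-free-strict⇒maxDegree≤2 : ∀ {n} (G : Graph n) → ¬ HasInduced G K1⊕C4 → IsStrictC4Split G →
  maxDegree G ≤ 2
K1⊕C4-free-strict⇒maxDegree≤2 G _ (P , (_ , _ , inj₁ noS , _) , s , Ps) = ⊥-elim (noS s Ps)
K1⊕C4-free-strict⇒maxDegree≤2 G free
  (P , (_ , indep , inj₂ (f , f-inj , f-onto , fS , f-pres) , CS , IS) , _) = maxDegree≤ G degree≤2
  where
  noC : ∀ v → P v ≢ partC
  noC c Pc = free (cone-over-C4⇒K1⊕C4 G (f , f-inj , f-pres) c λ i → CS c (f i) Pc (fS i))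
  I-isolated : ∀ {v u} → P v ≡ partI → Adj G v u → ⊥
  I-isolated {v} {u} Pv vu with P u in Pu
  ... | partC = noC u Pu
  ... | partS = true≢false (trans (sym vu) (IS v u Pv Pu))
  ... | partI = true≢false (trans (sym vu) (indep v u Pv Pu))
  S-neighbour : ∀ {i u} → Adj G (f i) u → u ∈ map f (C4-neighbours i)
  S-neighbour {i} {u} fi-u with P u in Pu
  ... | partC = ⊥-elim (noC u Pu)
  ... | partI = ⊥-elim (I-isolated Pu (trans (symm G u (f i)) fi-u))
  ... | partS with f-onto u Pu
  ... | j , refl = ∈-map⁺ f (C4-adjacent⇒∈neighbours i j (trans (sym (f-pres i j)) fi-u))
  degree≤2 : ∀ v → degree G v ≤ 2
  degree≤2 v with P v in Pv
  ... | partC = ⊥-elim (noC v Pv)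
  ... | partI = ≤-trans (degree≤length G v {ys = []} (⊥-elim ∘ I-isolated Pv)) z≤n
  ... | partS with f-onto v Pv
  ... | i , refl = degree≤length G (f i) S-neighbour

C4-split-bounded⇒K1⊕C4-free : ∀ {n} (G : Graph n) {P} → IsC4SplitPartition G P →
  (IsStrictC4Split G → maxDegree G ≤ 2) → ¬ HasInduced G K1⊕C4
C4-split-bounded⇒K1⊕C4-free G part@(_ , _ , inj₁ noS , _) _ K1⊕C4⊆G =
  C4-split-without-S⇒C4-free G part noS (HasInduced-trans G K1⊕C4 C4 K1⊕C4⊆G C4⊆K1⊕C4)
C4-split-bounded⇒K1⊕C4-free G {P} part@(_ , _ , inj₂ (f , _ , _ , fS , _) , _) bounded K1⊕C4⊆G
  with ≤-trans (K1⊕C4⊆G⇒4≤maxDegree G K1⊕C4⊆G) (bounded (P , part , f zero , fS zero))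
... | s≤s (s≤s ())

K1⊕C4-free⇒1kPolar : ∀ {n k} → 2 ≤ k → (G : Graph n) {P : Fin n → Part} → IsC4SplitPartition G P →
  ¬ HasInduced G K1⊕C4 → Is1kPolar k G
K1⊕C4-free⇒1kPolar 2≤k G part free = [ ⊥-elim ∘ free , id ] (C4-split⇒K1⊕C4⊎1kPolar 2≤k G part)

non-monopolar⇒K1⊕C4 : ∀ {n} (G : Graph n) {P : Fin n → Part} → IsC4SplitPartition G P →
  ¬ IsMonopolar G → HasInduced G K1⊕C4
non-monopolar⇒K1⊕C4 G part non-monopolar =
  [ id , (λ polar → ⊥-elim (non-monopolar (2 , polar))) ] (C4-split⇒K1⊕C4⊎1kPolar ≤-refl G part)

≅K1⊕C4⇒non-monopolar : ∀ {n} {G : Graph n} → G ≅ K1⊕C4 → ¬ IsMonopolar G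
≅K1⊕C4⇒non-monopolar {G = G} iso monopolar = monopolar⇒K1⊕C4-free G monopolar (≅⇒HasInduced (≅-sym iso))

≅K1⊕C4⇒deleted-monopolar : ∀ {m} {G : Graph (suc m)} → G ≅ K1⊕C4 → ∀ v → IsMonopolar (G -ᵛ v)
≅K1⊕C4⇒deleted-monopolar {G = G} iso v =
  2 , Is1kPolar-induced (K1⊕C4 -ᵛ to v) (G -ᵛ v) G-v⊆K1⊕C4-w (K1⊕C4-deleted-2Polar (to v))
  where
  open _≅_ iso
  G⊆K1⊕C4 : HasInduced K1⊕C4 G
  G⊆K1⊕C4 = ≅⇒HasInduced iso
  G-v⊆K1⊕C4-w : HasInduced (K1⊕C4 -ᵛ to v) (G -ᵛ v)
  G-v⊆K1⊕C4-w =
    HasInduced-avoiding K1⊕C4 (G -ᵛ v) (to v) (HasInduced-trans K1⊕C4 G (G -ᵛ v) G⊆K1⊕C4 (-ᵛ-HasInduced G v))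
      λ i eq → punchInᵢ≢i v i (proj₁ (proj₂ G⊆K1⊕C4) eq)

critical-K1⊕C4⊆G⇒surjective : ∀ {m} (G : Graph (suc m)) (K1⊕C4⊆G : HasInduced G K1⊕C4) →
  (∀ v → ¬ HasInduced (G -ᵛ v) K1⊕C4) → ∀ v → ∃ λ i → proj₁ K1⊕C4⊆G i ≡ v
critical-K1⊕C4⊆G⇒surjective G K1⊕C4⊆G@(g , _) critical v with any? (λ i → g i ≟ v)
... | yes hit  = hit
... | no  miss = ⊥-elim (critical v (HasInduced-avoiding G K1⊕C4 v K1⊕C4⊆G λ i eq → miss (i , eq)))

minimalObstruction⇔≅K1⊕C4 : ∀ {n} (G : Graph n) {P : Fin n → Part} → IsC4SplitPartition G P →
  IsMinimalMonopolarObstruction G ⇔ (G ≅ K1⊕C4)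
minimalObstruction⇔≅K1⊕C4 {zero} G part =
  mk⇔ (λ non-monopolar → ⊥-elim (¬Fin0 (proj₁ (non-monopolar⇒K1⊕C4 G part non-monopolar) zero)))
      ≅K1⊕C4⇒non-monopolar
minimalObstruction⇔≅K1⊕C4 {suc m} G part =
  mk⇔ (λ (non-monopolar , critical) →
         let K1⊕C4⊆G = non-monopolar⇒K1⊕C4 G part non-monopolar in
         surjective-HasInduced⇒≅ G K1⊕C4 K1⊕C4⊆G (critical-K1⊕C4⊆G⇒surjective G K1⊕C4⊆G
           λ v → monopolar⇒K1⊕C4-free (G -ᵛ v) (critical v)))
      (λ iso → ≅K1⊕C4⇒non-monopolar iso , ≅K1⊕C4⇒deleted-monopolar iso)

mainTheorem13 : ∀ {n : ℕ} (k : ℕ) → 2 ≤ k → (G : Graph n) (P : Fin n → Part) →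
    IsC4SplitPartition G P →
      ((Is1kPolar k G ⇔ (¬ HasInduced G K1⊕C4))
      × ((¬ HasInduced G K1⊕C4) ⇔ (IsStrictC4Split G → maxDegree G ≤ 2)))
    × (IsMinimalMonopolarObstruction G ⇔ (G ≅ K1⊕C4))
    × (IsStrictC4Split G → (IsMonopolar G ⇔ (maxDegree G ≤ 2)))
mainTheorem13 k 2≤k G P part =
  ( mk⇔ (1kPolar⇒K1⊕C4-free G) (K1⊕C4-free⇒1kPolar 2≤k G part)
  , mk⇔ (K1⊕C4-free-strict⇒maxDegree≤2 G) (C4-split-bounded⇒K1⊕C4-free G part) )
  , minimalObstruction⇔≅K1⊕C4 G part
  , λ strict →
      mk⇔ (λ monopolar → K1⊕C4-free-strict⇒maxDegree≤2 G (monopolar⇒K1⊕C4-free G monopolar) strict)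
          (λ Δ≤2 → 2 , K1⊕C4-free⇒1kPolar ≤-refl G part (C4-split-bounded⇒K1⊕C4-free G part λ _ → Δ≤2))
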